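{- Let $A,B\in\mathcal{F}_<$ each consist of a single branch, and suppose there is an epimorphism from $B$ onto $A$. Then $(A,B)$ is a Ramsey pair: for every natural number $r$ there exists $C\in\mathcal{F}_<$ such that for every colouring $c$ of the set of epimorphisms from $C$ onto $A$ with colours $\{1,\ldots,r\}$ there is an epimorphism $g:C\to B$ such that $\{h\circ g: h:B\to A\text{ an epimorphism}\}$ is $c$-monochromatic.
   Context: A fan is a finite acyclic undirected connected simple graph with a distinguished root such that every non-root vertex has degree at most 2; $\preceq$ is the tree order ($s\preceq t$ iff $s$ is on the path from $t$ to the root); a branch is a maximal $\preceq$-chain and its height is its number of vertices minus one. $\mathcal{F}_<$ is the class of finite structures $(A,R^A,S^A)$ where $A$ is a fan with all branches of the same height, $R^A(s,t)$ iff $s=t$ or $t$ is an immediate successor of $s$, and for some enumeration $a_1<\cdots<a_n$ of the branches, $S^A(x,y)$ iff $x\in a_i$, $y\in a_j$ for some $i\le j$. An epimorphism $f:B\to A$ is a surjection such that for $Q\in\{R,S\}$: $Q^A(x,y)$ iff $Q^B(x',y')$ for some $x',y'$ with $f(x')=x,f(y')=y$. -}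

module Defs where

open import Data.Nat using (ℕ; zero; suc; _≤_)
open import Data.Fin using (Fin; toℕ)
open import Data.Fin.Base using () renaming (_≤_ to _≤ᶠ_)
open import Data.Product using (Σ; ∃; ∃₂; _×_; _,_; proj₁; proj₂)
open import Data.Sum using (_⊎_; inj₁; inj₂)
open import Data.Unit using (⊤; tt)
open import Data.Empty using (⊥)
open import Relation.Binary.PropositionalEquality using (_≡_; refl; cong; trans; sym)

record Str : Set₁ where
  field
    Carrier : Set
    R       : Carrier → Carrier → Set
    S       : Carrier → Carrier → Set
open Str public

_⟺_ : Set → Set → Set
P ⟺ Q = (P → Q) × (Q → P)

Reflects : {B A : Set} → (B → A) → (B → B → Set) → (A → A → Set) → Set
Reflects {B} {A} f QB QA =
  ∀ (x y : A) → QA x y ⟺ (Σ B λ x' → Σ B λ y' → f x' ≡ x × f y' ≡ y × QB x' y')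

record Epi (B A : Str) : Set where
  field
    fun  : Carrier B → Carrier A
    surj : ∀ (y : Carrier A) → Σ (Carrier B) λ x → fun x ≡ y
    preR : Reflects fun (R B) (R A)
    preS : Reflects fun (S B) (S A)
open Epi public

private
  reflects-∘ : {C B A : Set} (g : C → B) (h : B → A)
    {QC : C → C → Set} {QB : B → B → Set} {QA : A → A → Set} →
    Reflects g QC QB → Reflects h QB QA →
    Reflects (λ z → h (g z)) QC QA
  reflects-∘ g h rg rh x y =
    (λ q → let (x' , y' , ex , ey , qb) = proj₁ (rh x y) q
               (x'' , y'' , ex' , ey' , qc) = proj₁ (rg x' y') qb
           in x'' , y'' , trans (cong h ex') ex , trans (cong h ey') ey , qc)
    , λ { (x'' , y'' , refl , refl , qc) →
            proj₂ (rh (h (g x'')) (h (g y''))) (g x'' , g y'' , refl , refl ,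
              proj₂ (rg (g x'') (g y'')) (x'' , y'' , refl , refl , qc)) }

_∘ᴱ_ : {C B A : Str} → Epi B A → Epi C B → Epi C A
_∘ᴱ_ {C} {B} {A} h g = record
  { fun  = λ z → fun h (fun g z)
  ; surj = λ y → let (b , eb) = surj h y ; (c , ec) = surj g b
                 in c , trans (cong (fun h) ec) eb
  ; preR = reflects-∘ (fun g) (fun h) (preR g) (preR h)
  ; preS = reflects-∘ (fun g) (fun h) (preS g) (preS h)
  }

-- Fan n h : a fan whose root has n branches, each of height h.
-- Vertices: the root, and (i , k) = the (k+1)-th vertex (depth k+1) of
-- branch i, for i : Fin n, k : Fin h.  Branches are enumerated
-- a₀ < a₁ < ... < a_{n-1} by their index.

FanV : ℕ → ℕ → Set
FanV n h = ⊤ ⊎ (Fin n × Fin h)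

root : ∀ {n h} → FanV n h
root = inj₁ tt

ImmSucc : ∀ {n h} → FanV n h → FanV n h → Set
ImmSucc (inj₁ _)       (inj₁ _)       = ⊥
ImmSucc (inj₁ _)       (inj₂ (i , k)) = toℕ k ≡ 0
ImmSucc (inj₂ _)       (inj₁ _)       = ⊥
ImmSucc (inj₂ (i , k)) (inj₂ (j , l)) = i ≡ j × toℕ l ≡ suc (toℕ k)

InBranch : ∀ {n h} → Fin n → FanV n h → Set
InBranch i (inj₁ _)       = ⊤
InBranch i (inj₂ (j , _)) = j ≡ i

FanR : ∀ {n h} → FanV n h → FanV n h → Set
FanR s t = s ≡ t ⊎ ImmSucc s t

FanS : ∀ {n h} → FanV n h → FanV n h → Set
FanS {n} x y = Σ (Fin n) λ i → Σ (Fin n) λ j → i ≤ᶠ j × InBranch i x × InBranch j y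

Fan : ℕ → ℕ → Str
Fan n h = record { Carrier = FanV n h ; R = FanR ; S = FanS }

-- A colouring of the set of epimorphisms C → A by r colours: it only
-- depends on the underlying map (epimorphisms are maps).
Colouring : Str → Str → ℕ → Set
Colouring C A r =
  Σ (Epi C A → Fin r) λ c →
    ∀ (e e' : Epi C A) → (∀ x → fun e x ≡ fun e' x) → c e ≡ c e'

-- (A , B) is a Ramsey pair (with C ranging over 𝓕_<, i.e. over fans
-- Fan n h with n ≥ 1 branches all of height h).
RamseyPair : Str → Str → Set
RamseyPair A B =
  ∀ (r : ℕ) → Σ ℕ λ n → Σ ℕ λ h → 1 ≤ n ×
    (∀ (c : Colouring (Fan n h) A r) →
       Σ (Epi (Fan n h) B) λ g → Σ (Fin r) λ col →
         ∀ (e : Epi B A) → proj₁ c (e ∘ᴱ g) ≡ col)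

-- Epimorphisms between single-branch fans, i.e. chains of heights m and a, are exactly the
-- rank maps of the a-element subsets of {0, …, m − 1} (the levels at which the map steps up),
-- and composing epimorphisms amounts to taking a subset of a subset.  So the Ramsey property of
-- (A , B) is the finite Ramsey theorem for a-subsets, proved by induction on a: first find a
-- large set on which the colour of an (a+1)-subset depends only on its least element, then
-- apply the pigeonhole principle to the colour of that element.

module Submission where

open import Defs
open import Data.Nat using (ℕ; zero; suc; _+_; _≤_; z≤n; s≤s)
open import Data.Nat.Properties using (suc-injective; +-suc; ≤-reflexive; ≤-antisym; m+n≡0⇒m≡0; +-identityʳ)
open import Data.Fin using (Fin; zero; suc; toℕ; inject₁; fromℕ; _≟_)
open import Data.Fin.Properties using (¬Fin0; toℕ-injective; toℕ-inject₁; toℕ≤pred[n]; toℕ-fromℕ)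
open import Data.Vec using (Vec; _∷_; lookup; replicate; sum; _[_]≔_)
open import Data.Vec.Properties using (lookup∘updateAt; lookup∘updateAt′; lookup-replicate)
open import Data.Product using (Σ; ∃; _×_; _,_; proj₂)
open import Data.Sum using (_⊎_; inj₁; inj₂)
open import Data.Unit using (tt)
open import Data.Empty using (⊥-elim)
open import Relation.Nullary using (yes; no)
open import Relation.Binary.PropositionalEquality

infix 4 _⊑_
infixr 9 _⊚_

-- a ⊑ m is an a-element subset of {0, …, m − 1}, listed from 0 upwards; u ⊚ w is the subset u
-- of (the elements of) w, read as a subset of {0, …, m − 1}.
data _⊑_ : ℕ → ℕ → Set where
  done : 0 ⊑ 0
  skip : ∀ {a m} → a ⊑ m → a ⊑ suc m
  keep : ∀ {a m} → a ⊑ m → suc a ⊑ suc m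

⊑-refl : ∀ m → m ⊑ m
⊑-refl zero    = done
⊑-refl (suc m) = keep (⊑-refl m)

none : ∀ m → 0 ⊑ m
none zero    = done
none (suc m) = skip (none m)

none-unique : ∀ {m} (u : 0 ⊑ m) → u ≡ none m
none-unique done     = refl
none-unique (skip u) = cong skip (none-unique u)

≤⇒⊑ : ∀ {a m} → a ≤ m → a ⊑ m
≤⇒⊑ {m = m} z≤n = none m
≤⇒⊑ (s≤s a≤m)   = keep (≤⇒⊑ a≤m)

_⊚_ : ∀ {a b m} → a ⊑ b → b ⊑ m → a ⊑ m
u      ⊚ done   = u
u      ⊚ skip w = skip (u ⊚ w)
skip u ⊚ keep w = skip (u ⊚ w)
keep u ⊚ keep w = keep (u ⊚ w)

⊚-assoc : ∀ {a b c m} (u : a ⊑ b) (v : b ⊑ c) (w : c ⊑ m) → (u ⊚ v) ⊚ w ≡ u ⊚ (v ⊚ w)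
⊚-assoc u        v        done     = refl
⊚-assoc u        v        (skip w) = cong skip (⊚-assoc u v w)
⊚-assoc u        (skip v) (keep w) = cong skip (⊚-assoc u v w)
⊚-assoc (skip u) (keep v) (keep w) = cong skip (⊚-assoc u v w)
⊚-assoc (keep u) (keep v) (keep w) = cong keep (⊚-assoc u v w)

least : ∀ {a m} → suc a ⊑ m → Fin m
least (skip u) = suc (least u)
least (keep u) = zero

Ramsey : ℕ → Set
Ramsey a = ∀ r b → ∃ λ m → ∀ (c : a ⊑ m → Fin (suc r)) →
  Σ (b ⊑ m) λ w → ∃ λ col → ∀ (u : a ⊑ b) → c (u ⊚ w) ≡ col

MinHomogeneous : ℕ → Set
MinHomogeneous a = ∀ r k → ∃ λ m → ∀ (c : suc a ⊑ m → Fin (suc r)) →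
  Σ (k ⊑ m) λ w → Σ (Fin k → Fin (suc r)) λ χ → ∀ (u : suc a ⊑ k) → c (u ⊚ w) ≡ χ (least u)

ramsey-zero : Ramsey 0
ramsey-zero r b = b , λ c → ⊑-refl b , c (none b) , λ u → cong c (none-unique (u ⊚ ⊑-refl b))

minHomogeneous : ∀ {a} → Ramsey a → MinHomogeneous a
minHomogeneous ramsey-a r zero = 0 , λ c → done , (λ ()) , λ ()
minHomogeneous {a} ramsey-a r (suc k) with minHomogeneous ramsey-a r k
... | M , homogeneous-M with ramsey-a r M
... | m , homogeneous-m = suc m , λ c → prepend c (homogeneous-m (λ v → c (keep v)))
  where
  prepend : (c : suc a ⊑ suc m → Fin (suc r)) →
    (Σ (M ⊑ m) λ w → ∃ λ col → ∀ (u : a ⊑ M) → c (keep (u ⊚ w)) ≡ col) →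
    Σ (suc k ⊑ suc m) λ w → Σ (Fin (suc k) → Fin (suc r)) λ χ →
      ∀ (u : suc a ⊑ suc k) → c (u ⊚ w) ≡ χ (least u)
  prepend c (w₁ , col , hom₁) with homogeneous-M (λ v → c (skip (v ⊚ w₁)))
  ... | w₂ , χ₂ , hom₂ = keep (w₂ ⊚ w₁) , χ , hom
    where
    χ : Fin (suc k) → Fin (suc r)
    χ zero    = col
    χ (suc i) = χ₂ i
    hom : ∀ (u : suc a ⊑ suc k) → c (u ⊚ keep (w₂ ⊚ w₁)) ≡ χ (least u)
    hom (keep u) = trans (cong (λ v → c (keep v)) (sym (⊚-assoc u w₂ w₁))) (hom₁ (u ⊚ w₂))
    hom (skip u) = trans (cong (λ v → c (skip v)) (sym (⊚-assoc u w₂ w₁))) (hom₂ u)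

-- least (u ⊚ s) ranges over the elements of s, so this says that χ is constant on s.
Monochromatic : ∀ {k m} {C : Set} → (Fin m → C) → C → k ⊑ m → Set
Monochromatic {k} χ col s = ∀ {a} (u : suc a ⊑ k) → χ (least (u ⊚ s)) ≡ col

monochromatic-skip : ∀ {k m} {C : Set} (χ : Fin (suc m) → C) {col} {s : k ⊑ m} →
  Monochromatic (λ i → χ (suc i)) col s → Monochromatic χ col (skip s)
monochromatic-skip χ mono u = mono u

monochromatic-keep : ∀ {k m} {C : Set} (χ : Fin (suc m) → C) {col} {s : k ⊑ m} → χ zero ≡ col →
  Monochromatic (λ i → χ (suc i)) col s → Monochromatic χ col (keep s)
monochromatic-keep χ χ₀ mono (keep u) = χ₀
monochromatic-keep χ χ₀ mono (skip u) = mono u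

monochromatic-none : ∀ {m} {C : Set} (χ : Fin m → C) col → Monochromatic χ col (none m)
monochromatic-none χ col ()

monochromatic-⊚ : ∀ {k l m} {C : Set} (χ : Fin m → C) {col} (v : k ⊑ l) {s : l ⊑ m} →
  Monochromatic χ col s → Monochromatic χ col (v ⊚ s)
monochromatic-⊚ χ v {s} mono u =
  trans (cong (λ w → χ (least w)) (sym (⊚-assoc u v s))) (mono (u ⊚ v))

sum-[]≔ : ∀ {r} (t : Vec ℕ r) i {j} → lookup t i ≡ suc j → sum t ≡ suc (sum (t [ i ]≔ j))
sum-[]≔ (x ∷ t) zero    refl = refl
sum-[]≔ (x ∷ t) (suc i) eq   = trans (cong (x +_) (sum-[]≔ t i eq)) (+-suc x _)

-- Colour col has the quota lookup t col, and the quotas add up to the number of positions;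
-- scanning the positions in order, some colour meets its quota before they run out.
pigeonhole-counts : ∀ {r} n (t : Vec ℕ (suc r)) → sum t ≡ n → (χ : Fin n → Fin (suc r)) →
  ∃ λ col → ∃ λ k → lookup t col ≤ k × Σ (k ⊑ n) (Monochromatic χ col)
pigeonhole-counts zero (x ∷ t) Σt≡0 χ =
  zero , 0 , ≤-reflexive (m+n≡0⇒m≡0 x Σt≡0) , done , λ ()
pigeonhole-counts (suc n) t Σt≡1+n χ with lookup t (χ zero) in tχ₀
... | zero = χ zero , 0 , ≤-reflexive tχ₀ , none (suc n) , monochromatic-none χ (χ zero)
... | suc j with pigeonhole-counts n (t [ χ zero ]≔ j)
                   (suc-injective (trans (sym (sum-[]≔ t (χ zero) tχ₀)) Σt≡1+n)) (λ i → χ (suc i))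
...   | col , k , le , s , mono with col ≟ χ zero
...     | yes refl = col , suc k , quota , keep s , monochromatic-keep χ refl mono
  where
  quota : lookup t col ≤ suc k
  quota = subst (_≤ suc k) (sym tχ₀) (s≤s (subst (_≤ k) (lookup∘updateAt col t) le))
...     | no col≢χ₀ = col , k , quota , skip s , monochromatic-skip χ mono
  where
  quota : lookup t col ≤ k
  quota = subst (_≤ k) (lookup∘updateAt′ col (χ zero) col≢χ₀ t) le

pigeonhole : ∀ r b → ∃ λ K → ∀ (χ : Fin K → Fin (suc r)) →
  Σ (b ⊑ K) λ s → ∃ λ col → Monochromatic χ col s
pigeonhole r b = K , λ χ → shrink χ (pigeonhole-counts K (replicate (suc r) b) refl χ)
  where
  K : ℕ
  K = sum (replicate (suc r) b)
  shrink : ∀ (χ : Fin K → Fin (suc r)) →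
    (∃ λ col → ∃ λ k → lookup (replicate (suc r) b) col ≤ k × Σ (k ⊑ K) (Monochromatic χ col)) →
    Σ (b ⊑ K) λ s → ∃ λ col → Monochromatic χ col s
  shrink χ (col , k , le , s , mono) = v ⊚ s , col , monochromatic-⊚ χ v mono
    where
    v : b ⊑ k
    v = ≤⇒⊑ (subst (_≤ k) (lookup-replicate col b) le)

ramsey-suc : ∀ {a} → Ramsey a → Ramsey (suc a)
ramsey-suc ramsey-a r b with pigeonhole r b
... | K , pigeon with minHomogeneous ramsey-a r K
... | m , min-homogeneous = m , λ c → homogeneous c (min-homogeneous c)
  where
  homogeneous : ∀ c →
    (Σ (K ⊑ m) λ w → Σ (Fin K → Fin (suc r)) λ χ → ∀ u → c (u ⊚ w) ≡ χ (least u)) →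
    Σ (b ⊑ m) λ w → ∃ λ col → ∀ u → c (u ⊚ w) ≡ col
  homogeneous c (w , χ , hom) with pigeon χ
  ... | s , col , mono =
    s ⊚ w , col , λ u → trans (cong c (sym (⊚-assoc u s w))) (trans (hom (u ⊚ s)) (mono u))

ramsey : ∀ a → Ramsey a
ramsey zero    = ramsey-zero
ramsey (suc a) = ramsey-suc (ramsey a)

level : ∀ {m} → FanV 1 m → Fin (suc m)
level (inj₁ _)       = zero
level (inj₂ (_ , k)) = suc k

vertex : ∀ {m} → Fin (suc m) → FanV 1 m
vertex zero    = root
vertex (suc k) = inj₂ (zero , k)

level-vertex : ∀ {m} (i : Fin (suc m)) → level (vertex i) ≡ i
level-vertex zero    = refl
level-vertex (suc k) = refl

vertex-level : ∀ {m} (x : FanV 1 m) → vertex (level x) ≡ x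
vertex-level (inj₁ _)          = refl
vertex-level (inj₂ (zero , k)) = refl

infix 4 _↝_

_↝_ : ℕ → ℕ → Set
x ↝ y = y ≡ x ⊎ y ≡ suc x

↝-suc : ∀ {x y} → x ↝ y → suc x ↝ suc y
↝-suc (inj₁ y≡x)   = inj₁ (cong suc y≡x)
↝-suc (inj₂ y≡1+x) = inj₂ (cong suc y≡1+x)

R⇒↝ : ∀ {m} {x y : FanV 1 m} → FanR x y → toℕ (level x) ↝ toℕ (level y)
R⇒↝ (inj₁ refl)                                = inj₁ refl
R⇒↝ {x = inj₁ _} {inj₂ _} (inj₂ k≡0)            = inj₂ (cong suc k≡0)
R⇒↝ {x = inj₂ _} {inj₂ _} (inj₂ (_ , l≡1+k))    = inj₂ (cong suc l≡1+k)

↝⇒R : ∀ {m} {i j : Fin (suc m)} → toℕ i ↝ toℕ j → FanR (vertex i) (vertex j)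
↝⇒R (inj₁ j≡i)                            = inj₁ (cong vertex (sym (toℕ-injective j≡i)))
↝⇒R {i = zero}  {suc zero}    (inj₂ _)     = inj₂ refl
↝⇒R {i = suc i} {suc j}       (inj₂ j≡1+i) = inj₂ (refl , suc-injective j≡1+i)
↝⇒R {i = zero}  {zero}        (inj₂ ())
↝⇒R {i = zero}  {suc (suc j)} (inj₂ ())
↝⇒R {i = suc i} {zero}        (inj₂ ())

-- rank w p is the number of elements of w below p: it steps up exactly at the elements of w.
rank : ∀ {a m} → a ⊑ m → Fin (suc m) → Fin (suc a)
rank _        zero    = zero
rank (skip w) (suc p) = rank w p
rank (keep w) (suc p) = suc (rank w p)

rank-⊚ : ∀ {a b m} (u : a ⊑ b) (w : b ⊑ m) p → rank u (rank w p) ≡ rank (u ⊚ w) p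
rank-⊚ u        w        zero    = refl
rank-⊚ u        (skip w) (suc p) = rank-⊚ u w p
rank-⊚ (skip u) (keep w) (suc p) = rank-⊚ u w p
rank-⊚ (keep u) (keep w) (suc p) = cong suc (rank-⊚ u w p)

rank-↝ : ∀ {a m} (w : a ⊑ m) {i j} → toℕ i ↝ toℕ j → toℕ (rank w i) ↝ toℕ (rank w j)
rank-↝ w (inj₁ j≡i) rewrite toℕ-injective j≡i = inj₁ refl
rank-↝ (skip w) {zero}  {suc zero}    (inj₂ _)     = inj₁ refl
rank-↝ (keep w) {zero}  {suc zero}    (inj₂ _)     = inj₂ refl
rank-↝ (skip w) {suc i} {suc j}       (inj₂ j≡1+i) = rank-↝ w (inj₂ (suc-injective j≡1+i))
rank-↝ (keep w) {suc i} {suc j}       (inj₂ j≡1+i) = ↝-suc (rank-↝ w (inj₂ (suc-injective j≡1+i)))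
rank-↝ w        {zero}  {zero}        (inj₂ ())
rank-↝ w        {zero}  {suc (suc j)} (inj₂ ())
rank-↝ w        {suc i} {zero}        (inj₂ ())

rank-surjective : ∀ {a m} (w : a ⊑ m) q → ∃ λ p → rank w p ≡ q
rank-surjective w        zero    = zero , refl
rank-surjective (skip w) (suc q) with rank-surjective w (suc q)
... | p , eq = suc p , eq
rank-surjective (keep w) (suc q) with rank-surjective w q
... | p , eq = suc p , cong suc eq

rank-lift : ∀ {a m} (w : a ⊑ m) {i j} → toℕ i ↝ toℕ j →
  ∃ λ p → ∃ λ p' → toℕ p ↝ toℕ p' × rank w p ≡ i × rank w p' ≡ j
rank-lift w {i} (inj₁ j≡i) with rank-surjective w i
... | p , eq = p , p , inj₁ refl , eq , trans eq (toℕ-injective (sym j≡i))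
rank-lift (skip w) (inj₂ j≡1+i) with rank-lift w (inj₂ j≡1+i)
... | p , p' , p↝p' , eq , eq' = suc p , suc p' , ↝-suc p↝p' , eq , eq'
rank-lift (keep w) {zero}  {suc zero} (inj₂ _) = zero , suc zero , inj₂ refl , refl , refl
rank-lift (keep w) {suc i} {suc j}    (inj₂ j≡1+i) with rank-lift w (inj₂ (suc-injective j≡1+i))
... | p , p' , p↝p' , eq , eq' = suc p , suc p' , ↝-suc p↝p' , cong suc eq , cong suc eq'
rank-lift done     {zero}  {zero}        (inj₂ ())
rank-lift (keep w) {zero}  {zero}        (inj₂ ())
rank-lift (keep w) {zero}  {suc (suc j)} (inj₂ ())
rank-lift (keep w) {suc i} {zero}        (inj₂ ())

chainMap : ∀ {a m} → a ⊑ m → FanV 1 m → FanV 1 a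
chainMap w x = vertex (rank w (level x))

chainMap-vertex : ∀ {a m} (w : a ⊑ m) p {x} → rank w p ≡ level x → chainMap w (vertex p) ≡ x
chainMap-vertex w p {x} eq = begin
  vertex (rank w (level (vertex p))) ≡⟨ cong (λ i → vertex (rank w i)) (level-vertex p) ⟩
  vertex (rank w p)                  ≡⟨ cong vertex eq ⟩
  vertex (level x)                   ≡⟨ vertex-level x ⟩
  x                                  ∎
  where open ≡-Reasoning

S-total : ∀ {m} (x y : FanV 1 m) → FanS x y
S-total x y = zero , zero , z≤n , in-branch x , in-branch y
  where
  in-branch : (x : FanV 1 _) → InBranch zero x
  in-branch (inj₁ _)          = tt
  in-branch (inj₂ (zero , _)) = refl

chainMap-reflects-R : ∀ {a m} (w : a ⊑ m) → Reflects (chainMap w) FanR FanR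
chainMap-reflects-R {m = m} w x y = lift , push
  where
  RPreimage : Set
  RPreimage = Σ (FanV 1 m) λ x' → Σ (FanV 1 m) λ y' →
    chainMap w x' ≡ x × chainMap w y' ≡ y × FanR x' y'
  lift : FanR x y → RPreimage
  lift r with rank-lift w (R⇒↝ r)
  ... | p , p' , p↝p' , eq , eq' =
    vertex p , vertex p' ,
    chainMap-vertex w p eq ,
    chainMap-vertex w p' eq' ,
    ↝⇒R p↝p'
  push : RPreimage → FanR x y
  push (x' , y' , refl , refl , r) = ↝⇒R (rank-↝ w (R⇒↝ r))

chainMap-surjective : ∀ {a m} (w : a ⊑ m) y → Σ (FanV 1 m) λ x → chainMap w x ≡ y
chainMap-surjective w y with rank-surjective w (level y)
... | p , eq = vertex p , chainMap-vertex w p eq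

chainMap-reflects-S : ∀ {a m} (w : a ⊑ m) → Reflects (chainMap w) FanS FanS
chainMap-reflects-S w x y =
  (λ _ → let (x' , ex) = chainMap-surjective w x ; (y' , ey) = chainMap-surjective w y
         in x' , y' , ex , ey , S-total x' y') ,
  λ _ → S-total x y

chainEpi : ∀ {a m} → a ⊑ m → Epi (Fan 1 m) (Fan 1 a)
chainEpi w = record
  { fun  = chainMap w
  ; surj = chainMap-surjective w
  ; preR = chainMap-reflects-R w
  ; preS = chainMap-reflects-S w
  }

chainMap-⊚ : ∀ {a b m} (u : a ⊑ b) (w : b ⊑ m) x →
  chainMap u (chainMap w x) ≡ chainMap (u ⊚ w) x
chainMap-⊚ u w x =
  cong vertex (trans (cong (rank u) (level-vertex (rank w (level x)))) (rank-⊚ u w (level x)))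

-- The offset f zero is there because the recursion continues with f ∘ suc.
rank-complete : ∀ {m} (f : Fin (suc m) → ℕ) → (∀ p → f (inject₁ p) ↝ f (suc p)) →
  ∃ λ a → Σ (a ⊑ m) λ u → ∀ p → f p ≡ f zero + toℕ (rank u p)
rank-complete {zero}  f steps = 0 , done , λ { zero → sym (+-identityʳ (f zero)) }
rank-complete {suc m} f steps with rank-complete (λ p → f (suc p)) (λ p → steps (suc p)) | steps zero
... | a , u , f≡ | inj₁ f₁≡f₀ = a , skip u , λ
  { zero    → sym (+-identityʳ (f zero))
  ; (suc p) → trans (f≡ p) (cong (_+ toℕ (rank u p)) f₁≡f₀) }
... | a , u , f≡ | inj₂ f₁≡1+f₀ = suc a , keep u , λ
  { zero    → sym (+-identityʳ (f zero))
  ; (suc p) → trans (f≡ p)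
      (trans (cong (_+ toℕ (rank u p)) f₁≡1+f₀) (sym (+-suc (f zero) (toℕ (rank u p))))) }

-- The level map ê of e moves by steps of 0 or 1, so it is rank u up to an offset; e hits the
-- root and the top, which forces the offset to be 0 and u to have a elements.
module _ {a b : ℕ} (e : Epi (Fan 1 b) (Fan 1 a)) where

  private
    ê : Fin (suc b) → Fin (suc a)
    ê p = level (fun e (vertex p))

    ê-level : ∀ x → ê (level x) ≡ level (fun e x)
    ê-level x = cong (λ y → level (fun e y)) (vertex-level x)

    ê-steps : ∀ p → toℕ (ê (inject₁ p)) ↝ toℕ (ê (suc p))
    ê-steps p = R⇒↝ (proj₂ (preR e _ _) (vertex (inject₁ p) , vertex (suc p) , refl , refl , edge))
      where
      edge : FanR (vertex (inject₁ p)) (vertex (suc p))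
      edge = ↝⇒R {i = inject₁ p} (inj₂ (cong suc (sym (toℕ-inject₁ p))))

    ê-hits : ∀ q → ∃ λ p → ê p ≡ q
    ê-hits q with surj e (vertex q)
    ... | x , ex = level x , trans (ê-level x) (trans (cong level ex) (level-vertex q))

    rank-represents : ∀ {a'} (u : a' ⊑ b) → (∀ p → toℕ (ê p) ≡ toℕ (ê zero) + toℕ (rank u p)) →
      ∀ p → toℕ (ê p) ≡ toℕ (rank u p)
    rank-represents u ê≡ p = trans (ê≡ p) (cong (_+ toℕ (rank u p)) ê₀≡0)
      where
      ê₀≡0 : toℕ (ê zero) ≡ 0
      ê₀≡0 with ê-hits zero
      ... | p₀ , ep₀ = m+n≡0⇒m≡0 (toℕ (ê zero)) (trans (sym (ê≡ p₀)) (cong toℕ ep₀))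

    rank-size : ∀ {a'} (u : a' ⊑ b) → (∀ p → toℕ (ê p) ≡ toℕ (rank u p)) → a' ≡ a
    rank-size {a'} u ê≡ = ≤-antisym a'≤a a≤a'
      where
      a'≤a : a' ≤ a
      a'≤a with rank-surjective u (fromℕ a')
      ... | p , eq =
        subst (_≤ a) (trans (ê≡ p) (trans (cong toℕ eq) (toℕ-fromℕ a'))) (toℕ≤pred[n] (ê p))
      a≤a' : a ≤ a'
      a≤a' with ê-hits (fromℕ a)
      ... | p , eq =
        subst (_≤ a') (trans (sym (ê≡ p)) (trans (cong toℕ eq) (toℕ-fromℕ a))) (toℕ≤pred[n] (rank u p))

    represent : ∀ {a'} (u : a' ⊑ b) → (∀ p → toℕ (ê p) ≡ toℕ (rank u p)) → a' ≡ a →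
      Σ (a ⊑ b) λ u → ∀ x → fun e x ≡ chainMap u x
    represent u ê≡ refl = u , λ x → begin
      fun e x                   ≡⟨ sym (vertex-level (fun e x)) ⟩
      vertex (level (fun e x))  ≡⟨ cong vertex (sym (ê-level x)) ⟩
      vertex (ê (level x))      ≡⟨ cong vertex (toℕ-injective (ê≡ (level x))) ⟩
      chainMap u x              ∎
      where open ≡-Reasoning

  chainEpi-complete : Σ (a ⊑ b) λ u → ∀ x → fun e x ≡ chainMap u x
  chainEpi-complete with rank-complete (λ p → toℕ (ê p)) ê-steps
  ... | a' , u , ê≡+offset = represent u ê≡ (rank-size u ê≡)
    where
    ê≡ : ∀ p → toℕ (ê p) ≡ toℕ (rank u p)
    ê≡ = rank-represents u ê≡+offset

-- The epimorphism B → A is only needed when there are no colours: it rules out a colouring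
-- of the epimorphisms C → A with values in Fin 0.
lemma6p2 : (a b : ℕ) → Epi (Fan 1 b) (Fan 1 a) → RamseyPair (Fan 1 a) (Fan 1 b)
lemma6p2 a b e zero =
  1 , b , s≤s z≤n , λ (c , _) → ⊥-elim (¬Fin0 (c (e ∘ᴱ chainEpi (⊑-refl b))))
lemma6p2 a b _ (suc r) with ramsey a r b
... | m , homogeneous = 1 , m , s≤s z≤n , λ (c , c-ext) →
  let (w , col , hom) = homogeneous (λ v → c (chainEpi v))
  in chainEpi w , col , λ e →
       let (u , e≗u) = chainEpi-complete e
       in trans (c-ext _ _ (λ x → trans (e≗u (chainMap w x)) (chainMap-⊚ u w x))) (hom u)
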